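{- For any pair of dominoes $d_0,d_1$ and any $u\in\Phi$, $\tau^u(d_0,d_1)=\tau^{ -u}(d_1,d_0)$. In particular, for every tiling $t$ of a region, $T^{ -u}(t)=T^u(t)$.
   Context: A basic cube is $C=(x,y,z)+[0,1]^3$ with $(x,y,z)\in\mathbb{Z}^3$; it is black if $x+y+z$ is odd and white if even. A region is a finite union of basic cubes; a domino is the union of two basic cubes sharing a face; a tiling of a region is a set of dominoes with pairwise disjoint interiors whose union is the region. $\Phi=\{\pm e_x,\pm e_y,\pm e_z\}$. For a domino $d$, $v(d)\in\Phi$ is the center of its black cube minus the center of its white cube. $\det(a,b,c)=a\cdot(b\times c)$. For $X\subset\mathbb{R}^3$, $u\in\Phi$, $S^u(X)=\operatorname{int}\big((X+[0,\infty)u)\setminus X\big)$. For dominoes $d_0,d_1$, $\tau^u(d_0,d_1)=\frac14\det(v(d_1),v(d_0),u)$ if $d_1\cap S^u(d_0)\neq\emptyset$ and $0$ otherwise; $T^u(t)=\sum_{d_0,d_1\in t}\tau^u(d_0,d_1)$ over ordered pairs. -}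

module Defs where

open import Data.Bool using (Bool; true; false; _∧_; _∨_; not; if_then_else_)
open import Data.Nat using (ℕ)
open import Data.Integer as ℤ using (ℤ; +_; -_; ∣_∣)
open import Data.Integer.Divisibility using (_∣_)
open import Data.Rational as ℚ using (ℚ; 0ℚ)
open import Data.List using (List; []; _∷_; foldr; map; concatMap; length; lookup)
open import Data.Bool.ListAction using (any)
open import Data.List.Membership.Propositional using (_∈_)
open import Data.List.Relation.Unary.Any using (Any)
open import Data.Fin using (Fin)
open import Data.Product using (_×_; _,_)
open import Relation.Nullary using (¬_; Dec; yes; no)
open import Relation.Nullary.Decidable using (⌊_⌋; _×-dec_)
open import Relation.Binary.PropositionalEquality using (_≡_; refl; cong₂)
open import Function.Bundles using (_⇔_)

-- Integer vectors in ℤ³.  A basic cube (x,y,z)+[0,1]³ is identified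
-- with its corner (x,y,z) ∈ ℤ³.

record V3 : Set where
  constructor v3
  field
    x y z : ℤ
open V3 public

Cube : Set
Cube = V3

_+ᵥ_ : V3 → V3 → V3
v3 a b c +ᵥ v3 a' b' c' = v3 (a ℤ.+ a') (b ℤ.+ b') (c ℤ.+ c')

_-ᵥ_ : V3 → V3 → V3
v3 a b c -ᵥ v3 a' b' c' = v3 (a ℤ.- a') (b ℤ.- b') (c ℤ.- c')

_·ᵥ_ : ℤ → V3 → V3
k ·ᵥ v3 a b c = v3 (k ℤ.* a) (k ℤ.* b) (k ℤ.* c)

dot : V3 → V3 → ℤ
dot (v3 a b c) (v3 a' b' c') = a ℤ.* a' ℤ.+ b ℤ.* b' ℤ.+ c ℤ.* c'

cross : V3 → V3 → V3
cross (v3 a b c) (v3 a' b' c') =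
  v3 (b ℤ.* c' ℤ.- c ℤ.* b') (c ℤ.* a' ℤ.- a ℤ.* c') (a ℤ.* b' ℤ.- b ℤ.* a')

det : V3 → V3 → V3 → ℤ
det a b c = dot a (cross b c)

_≟ᵥ_ : (u w : V3) → Dec (u ≡ w)
v3 a b c ≟ᵥ v3 a' b' c' with a ℤ.≟ a' | b ℤ.≟ b' | c ℤ.≟ c'
... | yes refl | yes refl | yes refl = yes refl
... | no ne | _ | _ = no λ { refl → ne refl }
... | yes _ | no ne | _ = no λ { refl → ne refl }
... | yes _ | yes _ | no ne = no λ { refl → ne refl }

IsWhite : Cube → Set
IsWhite c = (+ 2) ∣ (x c ℤ.+ y c ℤ.+ z c)

data Φ : Set where
  +ex -ex +ey -ey +ez -ez : Φ

vec : Φ → V3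
vec +ex = v3 (+ 1) (+ 0) (+ 0)
vec -ex = v3 (ℤ.- (+ 1)) (+ 0) (+ 0)
vec +ey = v3 (+ 0) (+ 1) (+ 0)
vec -ey = v3 (+ 0) (ℤ.- (+ 1)) (+ 0)
vec +ez = v3 (+ 0) (+ 0) (+ 1)
vec -ez = v3 (+ 0) (+ 0) (ℤ.- (+ 1))

neg : Φ → Φ
neg +ex = -ex
neg -ex = +ex
neg +ey = -ey
neg -ey = +ey
neg +ez = -ez
neg -ez = +ez

-- A domino is the union of two face-adjacent basic cubes;
-- exactly one is white.  We represent it by its white cube and the
-- direction v(d) ∈ Φ from the white cube's centre to the black cube's
-- centre (so the black cube is white + v(d)).

record Domino : Set where
  constructor domino
  field
    white   : Cube
    dir     : Φ
    isWhite : IsWhite white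
open Domino public

black : Domino → Cube
black d = white d +ᵥ vec (dir d)

v : Domino → V3
v d = vec (dir d)

cubes : Domino → List Cube
cubes d = white d ∷ black d ∷ []

memB : Cube → List Cube → Bool
memB c = any (λ c' → ⌊ c ≟ᵥ c' ⌋)

-- δ ∈ [0,∞)·u for an integer vector δ and u ∈ Φ: δ = k·u for some k ∈ ℕ.
-- The only possible k is ∣δ·u∣ (as u·u = 1), so this is decided by
-- checking δ = ∣δ·u∣·u.
onRayB : Φ → V3 → Bool
onRayB u δ = ⌊ δ ≟ᵥ ((+ ∣ dot δ (vec u) ∣) ·ᵥ vec u) ⌋

-- X + [0,∞)u, for X a union of basic cubes, is the union of the basic
-- cubes c' + k·u (c' a cube of X, k ∈ ℕ); S^u(X) is the interior of that
-- union minus X.  Since S^u(d₀) is open and d₁ is the closure of the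
-- interiors of its two cubes, d₁ meets S^u(d₀) iff some cube c of d₁
-- lies in the shadow, i.e. c = c' + k·u for a cube c' of d₀ and k ∈ ℕ,
-- and c is not a cube of d₀.
meetsShadowB : Φ → Domino → Domino → Bool
meetsShadowB u d₀ d₁ =
  any (λ c → not (memB c (cubes d₀)) ∧ any (λ c' → onRayB u (c -ᵥ c')) (cubes d₀))
      (cubes d₁)

τ : Φ → Domino → Domino → ℚ
τ u d₀ d₁ = if meetsShadowB u d₀ d₁
              then det (v d₁) (v d₀) (vec u) ℚ./ 4
              else 0ℚ

sumℚ : List ℚ → ℚ
sumℚ = foldr ℚ._+_ 0ℚ

T : Φ → List Domino → ℚ
T u t = sumℚ (concatMap (λ d₀ → map (λ d₁ → τ u d₀ d₁) t) t)

-- A tiling (a finite set of dominoes)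
-- is given by a list of dominoes; distinct entries (different positions)
-- have disjoint interiors (i.e. share no basic cube — this also excludes
-- repeated entries), and the union of the dominoes is the region.

Region : Set
Region = List Cube

IsTilingOf : Region → List Domino → Set
IsTilingOf R t =
  (∀ (i j : Fin (length t)) → ¬ (i ≡ j) →
     ∀ c → c ∈ cubes (lookup t i) → ¬ (c ∈ cubes (lookup t j)))
  × (∀ c → (c ∈ R) ⇔ Any (λ d → c ∈ cubes d) t)

{-# OPTIONS --safe #-}
module Submission where

-- Since det(v₀, v₁, −u) = det(v₁, v₀, u), the two sides carry the same weight, and
-- only the shadow indicators need comparing when that determinant is nonzero.  Then
-- u is parallel to neither v(d₀) nor v(d₁), so no two distinct cubes of one domino
-- lie on a common u-line.  Under that condition "some cube of d₁ outside d₀ lies on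
-- a u-ray from a cube of d₀" and "some cube of d₀ outside d₁ lies on a (−u)-ray from
-- a cube of d₁" both say: there are distinct cubes c₁ ∈ d₁, c₀ ∈ d₀ with
-- c₁ − c₀ ∈ ℕu.  Summed over ordered pairs, T^{−u}(t) is T^u(t) with each pair
-- reversed.

open import Defs
open import Data.Product using (_×_; _,_)
open import Data.List using (List; []; _∷_; _++_; foldr; map; concatMap)
open import Relation.Binary.PropositionalEquality
  using (_≡_; _≢_; refl; sym; trans; cong; cong₂; subst; module ≡-Reasoning)

open import Algebra.Bundles using (CommutativeMonoid)
open import Data.Bool using (Bool; true; false; _∧_; _∨_; not; if_then_else_)
  renaming (T to Tᵇ)
open import Data.Bool.ListAction using (any; or)
import Data.Bool.Properties as Boolₚ
open import Data.Empty using (⊥-elim)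
open import Data.Integer as ℤ using (ℤ; +_; -_; ∣_∣; 0ℤ; _+_; _-_; _*_)
import Data.Integer.Properties as ℤₚ
open import Data.Integer.Tactic.RingSolver using (solve-∀)
import Data.List.Properties as Listₚ
open import Data.List.Membership.Propositional using (_∈_)
open import Data.List.Relation.Unary.Any as Any using (here; there)
open import Data.List.Relation.Unary.Any.Properties using (any⁺; any⁻)
open import Data.Rational as ℚ using (0ℚ)
import Data.Rational.Properties as ℚₚ
open import Function using (_∘_; _⇔_; mk⇔; Equivalence)
open import Level using (Level)
open import Relation.Nullary using (yes; no)
open import Relation.Nullary.Decidable
  using (Dec; ⌊_⌋; isYes≗does; does-⇔; dec-false; toWitness; fromWitness; T?)

private
  variable
    a : Level
    A B : Set a

module DoubleSum {c ℓ} (M : CommutativeMonoid c ℓ) where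
  open CommutativeMonoid M renaming (refl to ≈-refl; sym to ≈-sym; trans to ≈-trans)
  open import Algebra.Properties.CommutativeSemigroup commutativeSemigroup
    using (interchange)

  ∑ : List Carrier → Carrier
  ∑ = foldr _∙_ ε

  ∑-++ : ∀ xs ys → ∑ (xs ++ ys) ≈ ∑ xs ∙ ∑ ys
  ∑-++ []       ys = ≈-sym (identityˡ _)
  ∑-++ (x ∷ xs) ys = ≈-trans (∙-congˡ (∑-++ xs ys)) (≈-sym (assoc _ _ _))

  ∑-concatMap : ∀ (g : A → List Carrier) xs →
                ∑ (concatMap g xs) ≈ ∑ (map (∑ ∘ g) xs)
  ∑-concatMap g []       = ≈-refl
  ∑-concatMap g (x ∷ xs) = ≈-trans (∑-++ (g x) _) (∙-congˡ (∑-concatMap g xs))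

  ∑-map-ε : (xs : List A) → ∑ (map (λ _ → ε) xs) ≈ ε
  ∑-map-ε []       = ≈-refl
  ∑-map-ε (_ ∷ xs) = ≈-trans (identityˡ _) (∑-map-ε xs)

  ∑-map-∙ : ∀ (f g : A → Carrier) xs →
            ∑ (map (λ x → f x ∙ g x) xs) ≈ ∑ (map f xs) ∙ ∑ (map g xs)
  ∑-map-∙ f g []       = ≈-sym (identityˡ ε)
  ∑-map-∙ f g (x ∷ xs) = ≈-trans (∙-congˡ (∑-map-∙ f g xs)) (interchange _ _ _ _)

  ∑∑-comm : ∀ (f : A → B → Carrier) xs ys →
            ∑ (map (λ x → ∑ (map (f x) ys)) xs) ≈
            ∑ (map (λ y → ∑ (map (λ x → f x y) xs)) ys)
  ∑∑-comm f []       ys = ≈-sym (∑-map-ε ys)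
  ∑∑-comm f (x ∷ xs) ys =
    ≈-trans (∙-congˡ (∑∑-comm f xs ys)) (≈-sym (∑-map-∙ (f x) _ ys))

  ∑-concatMap-comm : ∀ (f : A → B → Carrier) xs ys →
                     ∑ (concatMap (λ x → map (f x) ys) xs) ≈
                     ∑ (concatMap (λ y → map (λ x → f x y) xs) ys)
  ∑-concatMap-comm f xs ys = begin
    ∑ (concatMap (λ x → map (f x) ys) xs)            ≈⟨ ∑-concatMap _ xs ⟩
    ∑ (map (λ x → ∑ (map (f x) ys)) xs)              ≈⟨ ∑∑-comm f xs ys ⟩
    ∑ (map (λ y → ∑ (map (λ x → f x y) xs)) ys)      ≈⟨ ≈-sym (∑-concatMap _ ys) ⟩
    ∑ (concatMap (λ y → map (λ x → f x y) xs) ys)    ∎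
    where open import Relation.Binary.Reasoning.Setoid setoid

infix 30 -ᵥ_

-ᵥ_ : V3 → V3
-ᵥ v3 a b c = v3 (- a) (- b) (- c)

private
  v3-cong : ∀ {a b c a′ b′ c′} → a ≡ a′ → b ≡ b′ → c ≡ c′ → v3 a b c ≡ v3 a′ b′ c′
  v3-cong refl refl refl = refl

vec-neg : ∀ u → vec (neg u) ≡ -ᵥ vec u
vec-neg +ex = refl
vec-neg -ex = refl
vec-neg +ey = refl
vec-neg -ey = refl
vec-neg +ez = refl
vec-neg -ez = refl

-ᵥ-injective : ∀ {a b} → -ᵥ a ≡ -ᵥ b → a ≡ b
-ᵥ-injective {v3 _ _ _} {v3 _ _ _} eq =
  v3-cong (ℤₚ.neg-injective (cong x eq))
          (ℤₚ.neg-injective (cong y eq))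
          (ℤₚ.neg-injective (cong z eq))

-ᵥ-sub : ∀ a b → -ᵥ (a -ᵥ b) ≡ b -ᵥ a
-ᵥ-sub (v3 a₁ a₂ a₃) (v3 b₁ b₂ b₃) = v3-cong (neg-sub a₁ b₁) (neg-sub a₂ b₂) (neg-sub a₃ b₃)
  where
  neg-sub : ∀ i j → - (i - j) ≡ j - i
  neg-sub = solve-∀

+ᵥ-sub-cancelˡ : ∀ w s → (w +ᵥ s) -ᵥ w ≡ s
+ᵥ-sub-cancelˡ (v3 w₁ w₂ w₃) (v3 s₁ s₂ s₃) = v3-cong (cancel w₁ s₁) (cancel w₂ s₂) (cancel w₃ s₃)
  where
  cancel : ∀ i j → (i + j) - i ≡ j
  cancel = solve-∀

sub-+ᵥ-cancelˡ : ∀ w s → w -ᵥ (w +ᵥ s) ≡ -ᵥ s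
sub-+ᵥ-cancelˡ (v3 w₁ w₂ w₃) (v3 s₁ s₂ s₃) = v3-cong (cancel w₁ s₁) (cancel w₂ s₂) (cancel w₃ s₃)
  where
  cancel : ∀ i j → i - (i + j) ≡ - j
  cancel = solve-∀

·ᵥ-neg : ∀ k a → k ·ᵥ (-ᵥ a) ≡ -ᵥ (k ·ᵥ a)
·ᵥ-neg k (v3 a₁ a₂ a₃) =
  v3-cong (sym (ℤₚ.neg-distribʳ-* k a₁))
          (sym (ℤₚ.neg-distribʳ-* k a₂))
          (sym (ℤₚ.neg-distribʳ-* k a₃))

-- The ring solver does not unfold dot or det, so these identities are restated on
-- coordinates.
dot-neg : ∀ a b → dot (-ᵥ a) (-ᵥ b) ≡ dot a b
dot-neg (v3 a₁ a₂ a₃) (v3 b₁ b₂ b₃) = expand a₁ a₂ a₃ b₁ b₂ b₃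
  where
  expand : ∀ a₁ a₂ a₃ b₁ b₂ b₃ →
           - a₁ * - b₁ + - a₂ * - b₂ + - a₃ * - b₃ ≡
           a₁ * b₁ + a₂ * b₂ + a₃ * b₃
  expand = solve-∀

det-swap-neg : ∀ a b c → det b a (-ᵥ c) ≡ det a b c
det-swap-neg (v3 a₁ a₂ a₃) (v3 b₁ b₂ b₃) (v3 c₁ c₂ c₃) = expand a₁ a₂ a₃ b₁ b₂ b₃ c₁ c₂ c₃
  where
  expand : ∀ a₁ a₂ a₃ b₁ b₂ b₃ c₁ c₂ c₃ →
    b₁ * (a₂ * - c₃ - a₃ * - c₂) + b₂ * (a₃ * - c₁ - a₁ * - c₃) + b₃ * (a₁ * - c₂ - a₂ * - c₁) ≡
    a₁ * (b₂ * c₃ - b₃ * c₂) + a₂ * (b₃ * c₁ - b₁ * c₃) + a₃ * (b₁ * c₂ - b₂ * c₁)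
  expand = solve-∀

det-neg₂ : ∀ a b c → det a (-ᵥ b) c ≡ - det a b c
det-neg₂ (v3 a₁ a₂ a₃) (v3 b₁ b₂ b₃) (v3 c₁ c₂ c₃) = expand a₁ a₂ a₃ b₁ b₂ b₃ c₁ c₂ c₃
  where
  expand : ∀ a₁ a₂ a₃ b₁ b₂ b₃ c₁ c₂ c₃ →
    a₁ * (- b₂ * c₃ - - b₃ * c₂) + a₂ * (- b₃ * c₁ - - b₁ * c₃) + a₃ * (- b₁ * c₂ - - b₂ * c₁) ≡
    - (a₁ * (b₂ * c₃ - b₃ * c₂) + a₂ * (b₃ * c₁ - b₁ * c₃) + a₃ * (b₁ * c₂ - b₂ * c₁))
  expand = solve-∀

det-collinear₂₃ : ∀ a k c → det a (k ·ᵥ c) c ≡ 0ℤ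
det-collinear₂₃ (v3 a₁ a₂ a₃) k (v3 c₁ c₂ c₃) = expand a₁ a₂ a₃ k c₁ c₂ c₃
  where
  expand : ∀ a₁ a₂ a₃ k c₁ c₂ c₃ →
    a₁ * (k * c₂ * c₃ - k * c₃ * c₂) + a₂ * (k * c₃ * c₁ - k * c₁ * c₃) +
    a₃ * (k * c₁ * c₂ - k * c₂ * c₁) ≡ 0ℤ
  expand = solve-∀

det-vec-neg : ∀ a b u → det a b (vec (neg u)) ≡ det b a (vec u)
det-vec-neg a b u = trans (cong (det a b) (vec-neg u)) (det-swap-neg b a (vec u))

⌊⌋-⇔ : ∀ {p q} {P : Set p} {Q : Set q} →
       P ⇔ Q → (p? : Dec P) (q? : Dec Q) → ⌊ p? ⌋ ≡ ⌊ q? ⌋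
⌊⌋-⇔ P⇔Q p? q? = trans (isYes≗does p?) (trans (does-⇔ P⇔Q p? q?) (sym (isYes≗does q?)))

onRayB′ : V3 → V3 → Bool
onRayB′ e δ = ⌊ δ ≟ᵥ ((+ ∣ dot δ e ∣) ·ᵥ e) ⌋

onRayB′-neg : ∀ e δ → onRayB′ (-ᵥ e) (-ᵥ δ) ≡ onRayB′ e δ
onRayB′-neg e δ = begin
  ⌊ -ᵥ δ ≟ᵥ ((+ ∣ dot (-ᵥ δ) (-ᵥ e) ∣) ·ᵥ -ᵥ e) ⌋
    ≡⟨ cong (λ k → ⌊ -ᵥ δ ≟ᵥ ((+ ∣ k ∣) ·ᵥ -ᵥ e) ⌋) (dot-neg δ e) ⟩
  ⌊ -ᵥ δ ≟ᵥ ((+ n) ·ᵥ -ᵥ e) ⌋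
    ≡⟨ cong (λ w → ⌊ -ᵥ δ ≟ᵥ w ⌋) (·ᵥ-neg (+ n) e) ⟩
  ⌊ -ᵥ δ ≟ᵥ -ᵥ ((+ n) ·ᵥ e) ⌋
    ≡⟨ ⌊⌋-⇔ (mk⇔ -ᵥ-injective (cong (λ w → -ᵥ w)))
            (-ᵥ δ ≟ᵥ -ᵥ ((+ n) ·ᵥ e)) (δ ≟ᵥ ((+ n) ·ᵥ e)) ⟩
  ⌊ δ ≟ᵥ ((+ n) ·ᵥ e) ⌋ ∎
  where
  open ≡-Reasoning
  n = ∣ dot δ e ∣

onRayB-neg : ∀ u a b → onRayB (neg u) (a -ᵥ b) ≡ onRayB u (b -ᵥ a)
onRayB-neg u a b = begin
  onRayB′ (vec (neg u)) (a -ᵥ b)      ≡⟨ cong₂ onRayB′ (vec-neg u) (sym (-ᵥ-sub b a)) ⟩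
  onRayB′ (-ᵥ vec u) (-ᵥ (b -ᵥ a))    ≡⟨ onRayB′-neg (vec u) (b -ᵥ a) ⟩
  onRayB′ (vec u) (b -ᵥ a)            ∎
  where open ≡-Reasoning

onRayB-det : ∀ a u δ → Tᵇ (onRayB u δ) → det a δ (vec u) ≡ 0ℤ
onRayB-det a u δ ray =
  trans (cong (λ w → det a w (vec u)) (toWitness ray))
        (det-collinear₂₃ a (+ ∣ dot δ (vec u) ∣) (vec u))

RayFree : Φ → List Cube → Set
RayFree u cs = ∀ {b c} → b ∈ cs → c ∈ cs → Tᵇ (onRayB u (c -ᵥ b)) → c ≡ b

ray-free-domino : ∀ {a u} d → det a (v d) (vec u) ≢ 0ℤ → RayFree u (cubes d)
ray-free-domino d _ (here refl)         (here refl)         _ = refl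
ray-free-domino d _ (there (here refl)) (there (here refl)) _ = refl
ray-free-domino {a} {u} d D≢0 (here refl) (there (here refl)) ray =
  ⊥-elim (D≢0 (trans (cong (λ w → det a w (vec u)) (sym (+ᵥ-sub-cancelˡ (white d) (v d))))
                     (onRayB-det a u _ ray)))
ray-free-domino {a} {u} d D≢0 (there (here refl)) (here refl) ray =
  ⊥-elim (D≢0 (ℤₚ.neg-injective (begin
    - det a (v d) (vec u)                  ≡⟨ sym (det-neg₂ a (v d) (vec u)) ⟩
    det a (-ᵥ v d) (vec u)
      ≡⟨ cong (λ w → det a w (vec u)) (sym (sub-+ᵥ-cancelˡ (white d) (v d))) ⟩
    det a (white d -ᵥ black d) (vec u)     ≡⟨ onRayB-det a u _ ray ⟩
    0ℤ                                     ∎)))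
  where open ≡-Reasoning
ray-free-domino d _ (there (there ())) _
ray-free-domino d _ _ (there (there ()))

any-cong-∈ : ∀ {p q : A → Bool} xs → (∀ {x} → x ∈ xs → p x ≡ q x) → any p xs ≡ any q xs
any-cong-∈ []       _  = refl
any-cong-∈ (x ∷ xs) eq = cong₂ _∨_ (eq (here refl)) (any-cong-∈ xs (eq ∘ there))

any-cong : ∀ {p q : A → Bool} → (∀ x → p x ≡ q x) → ∀ xs → any p xs ≡ any q xs
any-cong eq xs = cong or (Listₚ.map-cong eq xs)

any-false-∈ : ∀ {p : A → Bool} xs → (∀ {x} → x ∈ xs → p x ≡ false) → any p xs ≡ false
any-false-∈ []       _  = refl
any-false-∈ (x ∷ xs) eq rewrite eq (here refl) = any-false-∈ xs (eq ∘ there)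

memB⇔ : ∀ {c} cs → Tᵇ (memB c cs) ⇔ c ∈ cs
memB⇔ cs = mk⇔ (Any.map toWitness ∘ any⁻ _ cs) (any⁺ _ ∘ Any.map fromWitness)

≟ᵥ-sym : ∀ a b → ⌊ a ≟ᵥ b ⌋ ≡ ⌊ b ≟ᵥ a ⌋
≟ᵥ-sym a b = ⌊⌋-⇔ (mk⇔ sym sym) (a ≟ᵥ b) (b ≟ᵥ a)

not-memB∧any : ∀ {c cs} (r : Cube → Bool) →
               (∀ {b} → b ∈ cs → c ∈ cs → Tᵇ (r b) → c ≡ b) →
               not (memB c cs) ∧ any r cs ≡ any (λ b → not ⌊ c ≟ᵥ b ⌋ ∧ r b) cs
not-memB∧any {c} {cs} r rigid with memB c cs in c∈?
... | true = sym (any-false-∈ cs excluded)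
  where
  c∈cs : c ∈ cs
  c∈cs = Equivalence.to (memB⇔ cs) (subst Tᵇ (sym c∈?) _)
  excluded : ∀ {b} → b ∈ cs → not ⌊ c ≟ᵥ b ⌋ ∧ r b ≡ false
  excluded {b} b∈cs with c ≟ᵥ b
  ... | yes _   = refl
  ... | no  c≢b = dec-false (T? (r b)) (c≢b ∘ rigid b∈cs c∈cs)
... | false = any-cong-∈ cs distinct
  where
  distinct : ∀ {b} → b ∈ cs → r b ≡ not ⌊ c ≟ᵥ b ⌋ ∧ r b
  distinct {b} b∈cs with c ≟ᵥ b
  ... | no _     = refl
  ... | yes refl = ⊥-elim (subst Tᵇ c∈? (Equivalence.from (memB⇔ cs) b∈cs))

module ∨ = DoubleSum Boolₚ.∨-commutativeMonoid

shadow-sym : ∀ u A B → RayFree u A → RayFree (neg u) B →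
  any (λ c → not (memB c A) ∧ any (λ c′ → onRayB u (c -ᵥ c′)) A) B ≡
  any (λ c′ → not (memB c′ B) ∧ any (λ c → onRayB (neg u) (c′ -ᵥ c)) B) A
shadow-sym u A B free-A free-B = begin
  any (λ c → not (memB c A) ∧ any (λ c′ → onRayB u (c -ᵥ c′)) A) B
    ≡⟨ any-cong (λ c → not-memB∧any {c} (λ c′ → onRayB u (c -ᵥ c′)) free-A) B ⟩
  any (λ c → any (λ c′ → not ⌊ c ≟ᵥ c′ ⌋ ∧ onRayB u (c -ᵥ c′)) A) B
    ≡⟨ ∨.∑∑-comm (λ c c′ → not ⌊ c ≟ᵥ c′ ⌋ ∧ onRayB u (c -ᵥ c′)) B A ⟩
  any (λ c′ → any (λ c → not ⌊ c ≟ᵥ c′ ⌋ ∧ onRayB u (c -ᵥ c′)) B) A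
    ≡⟨ any-cong (λ c′ → any-cong (λ c →
         cong₂ (λ e r → not e ∧ r) (≟ᵥ-sym c c′) (sym (onRayB-neg u c′ c))) B) A ⟩
  any (λ c′ → any (λ c → not ⌊ c′ ≟ᵥ c ⌋ ∧ onRayB (neg u) (c′ -ᵥ c)) B) A
    ≡⟨ sym (any-cong (λ c′ → not-memB∧any {c′} (λ c → onRayB (neg u) (c′ -ᵥ c)) free-B) A) ⟩
  any (λ c′ → not (memB c′ B) ∧ any (λ c → onRayB (neg u) (c′ -ᵥ c)) B) A ∎
  where open ≡-Reasoning

meetsShadowB-sym : ∀ u d₀ d₁ → det (v d₁) (v d₀) (vec u) ≢ 0ℤ →
                   meetsShadowB u d₀ d₁ ≡ meetsShadowB (neg u) d₁ d₀
meetsShadowB-sym u d₀ d₁ D≢0 =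
  shadow-sym u (cubes d₀) (cubes d₁)
    (ray-free-domino {v d₁} {u} d₀ D≢0) (ray-free-domino {v d₀} {neg u} d₁ D′≢0)
  where
  D′≢0 : det (v d₀) (v d₁) (vec (neg u)) ≢ 0ℤ
  D′≢0 = D≢0 ∘ trans (sym (det-vec-neg (v d₀) (v d₁) u))

if-/4-zero : ∀ b {D} → D ≡ 0ℤ → (if b then D ℚ./ 4 else 0ℚ) ≡ 0ℚ
if-/4-zero false _    = refl
if-/4-zero true  refl = refl

τ-sym : ∀ u d₀ d₁ → τ u d₀ d₁ ≡ τ (neg u) d₁ d₀
τ-sym u d₀ d₁ with det (v d₁) (v d₀) (vec u) ℤ.≟ 0ℤ
... | yes D≡0 =
  trans (if-/4-zero (meetsShadowB u d₀ d₁) D≡0)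
        (sym (if-/4-zero (meetsShadowB (neg u) d₁ d₀) (trans (det-vec-neg (v d₀) (v d₁) u) D≡0)))
... | no D≢0 =
  cong₂ (λ b D → if b then D ℚ./ 4 else 0ℚ)
        (meetsShadowB-sym u d₀ d₁ D≢0) (sym (det-vec-neg (v d₀) (v d₁) u))

module ℚ+ = DoubleSum ℚₚ.+-0-commutativeMonoid

T-neg : ∀ u t → T (neg u) t ≡ T u t
T-neg u t = begin
  T (neg u) t
    ≡⟨ cong sumℚ (Listₚ.concatMap-cong
         (λ d₀ → Listₚ.map-cong (λ d₁ → sym (τ-sym u d₁ d₀)) t) t) ⟩
  sumℚ (concatMap (λ d₀ → map (λ d₁ → τ u d₁ d₀) t) t)
    ≡⟨ ℚ+.∑-concatMap-comm (λ d₀ d₁ → τ u d₁ d₀) t t ⟩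
  T u t ∎
  where open ≡-Reasoning

lemma3p1 : ((u : Φ) (d₀ d₁ : Domino) → τ u d₀ d₁ ≡ τ (neg u) d₁ d₀)
           × ((R : Region) (t : List Domino) → IsTilingOf R t →
              (u : Φ) → T (neg u) t ≡ T u t)
lemma3p1 = τ-sym , λ _ t _ u → T-neg u t
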